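{- Let $\Sigma \subseteq E(K_6)$ be a signature of the complete graph $K_6$, and let $\Sigma'$ be a minimal signature equivalent to $\Sigma$, i.e. a signature switching equivalent to $\Sigma$ with the minimum number of edges among all signatures switching equivalent to $\Sigma$. Then $|\Sigma'| \le 6$.
   Context: A signature of a graph $G$ is a set $\Sigma \subseteq E(G)$ of negative edges. Switching at a vertex $v$ replaces $\Sigma$ by its symmetric difference with the set of edges incident to $v$. Two signatures are switching equivalent if one is obtained from the other by a sequence of switchings. -}

module Defs where

open import Data.Nat using (ℕ; _<_; _≤_)
open import Data.Fin using (Fin; toℕ)
open import Data.Fin.Properties using (_≟_)
open import Data.Bool using (Bool; true; false; _xor_; if_then_else_)
open import Data.Product using (Σ; _,_; proj₁; proj₂)
open import Data.List using (List; []; _∷_; length; filter; concatMap; allFin)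
open import Relation.Nullary using (does)
open import Data.Nat using (_<?_)
open import Relation.Binary.PropositionalEquality using (_≡_)

-- Edges of the complete graph K_n: unordered pairs {i,j}, represented as i < j.
record Edge (n : ℕ) : Set where
  constructor edge
  field
    u : Fin n
    v : Fin n
    u<v : toℕ u < toℕ v

-- A signature Σ ⊆ E(K_n), given by its indicator function (true = negative edge).
Signature : ℕ → Set
Signature n = Edge n → Bool

incident : ∀ {n} → Fin n → Edge n → Bool
incident x (edge a b _) = does (x ≟ a) Data.Bool.∨ does (x ≟ b)

switch : ∀ {n} → Fin n → Signature n → Signature n
switch x σ e = σ e xor incident x e

_≐_ : ∀ {n} → Signature n → Signature n → Set
σ ≐ τ = ∀ e → σ e ≡ τ e

data SwitchEquiv {n : ℕ} : Signature n → Signature n → Set where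
  same : ∀ {σ τ} → σ ≐ τ → SwitchEquiv σ τ
  step : ∀ {σ τ} (x : Fin n) → SwitchEquiv (switch x σ) τ → SwitchEquiv σ τ

edgesOf : ∀ n → List (Edge n)
edgesOf n = concatMap (λ i → concatMap (λ j → pairs i j) (allFin n)) (allFin n)
  where
  pairs : Fin n → Fin n → List (Edge n)
  pairs i j with toℕ i <? toℕ j
  ... | Relation.Nullary.yes p = edge i j p ∷ []
  ... | Relation.Nullary.no _ = []

size : ∀ {n} → Signature n → ℕ
size {n} σ = length (filter (λ e → Data.Bool._≟_ (σ e) true) (edgesOf n))

MinimalEquiv : ∀ {n} → Signature n → Signature n → Set
MinimalEquiv {n} σ σ' =
  SwitchEquiv σ σ' Data.Product.× (∀ τ → SwitchEquiv σ τ → size σ' ≤ size τ)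

-- A minimal signature is in particular locally minimal: switching at a single
-- vertex x cannot decrease it.  Switching at x trades the d(x) negative edges at x
-- for the 5 − d(x) positive ones, so every vertex of K₆ meets at most ⌊5/2⌋ = 2
-- negative edges, and by the handshake lemma the signature has at most 6·2/2 edges.
module Submission where

open import Defs
open import Data.Bool using (Bool; true; false; _xor_; _∧_; _∨_)
open import Data.Fin using (Fin; zero; suc; toℕ)
open import Data.Fin.Properties using (_≟_)
open import Data.List using ([]; _∷_; map; filter; length)
open import Data.List.Properties using (map-cong)
open import Data.Nat using (ℕ; zero; suc; _+_; _*_; _≤_; z≤n; s≤s; s≤s⁻¹)
open import Data.Nat.ListAction using (sum)
open import Data.Nat.Properties
  using (+-0-commutativeMonoid; +-commutativeSemigroup; +-mono-≤; +-cancelˡ-≤; *-distribˡ-+; *-zeroʳ;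
         *-cancelˡ-≤; *-cancelˡ-<; ≤-refl; <⇒≢; module ≤-Reasoning)
open import Data.Product using (_,_)
open import Relation.Binary.PropositionalEquality
  using (_≡_; _≢_; refl; sym; cong; cong₂; subst; module ≡-Reasoning)
open import Relation.Nullary using (does; yes; no; contradiction)
open import Algebra.Properties.CommutativeSemigroup +-commutativeSemigroup
  using () renaming (interchange to +-interchange)
open import Algebra.Properties.CommutativeMonoid.Sum +-0-commutativeMonoid
  using (sum-syntax; sum-cong-≗; ∑-distrib-+; sum-replicate-zero)

bit : Bool → ℕ
bit true  = 1
bit false = 0

bit-xor+2*∧ : ∀ a b → bit (a xor b) + 2 * bit (a ∧ b) ≡ bit a + bit b
bit-xor+2*∧ true  true  = refl
bit-xor+2*∧ true  false = refl
bit-xor+2*∧ false true  = refl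
bit-xor+2*∧ false false = refl

module _ {A : Set} where

  sum-map-+ : ∀ (f g : A → ℕ) l →
              sum (map (λ a → f a + g a) l) ≡ sum (map f l) + sum (map g l)
  sum-map-+ f g []      = refl
  sum-map-+ f g (a ∷ l) = begin
    (f a + g a) + sum (map (λ a → f a + g a) l)    ≡⟨ cong ((f a + g a) +_) (sum-map-+ f g l) ⟩
    (f a + g a) + (sum (map f l) + sum (map g l))  ≡⟨ +-interchange (f a) (g a) _ _ ⟩
    (f a + sum (map f l)) + (g a + sum (map g l))  ∎
    where open ≡-Reasoning

  sum-map-*ˡ : ∀ c (f : A → ℕ) l → sum (map (λ a → c * f a) l) ≡ c * sum (map f l)
  sum-map-*ˡ c f []      = sym (*-zeroʳ c)
  sum-map-*ˡ c f (a ∷ l) = begin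
    c * f a + sum (map (λ a → c * f a) l)  ≡⟨ cong (c * f a +_) (sum-map-*ˡ c f l) ⟩
    c * f a + c * sum (map f l)            ≡⟨ sym (*-distribˡ-+ c (f a) _) ⟩
    c * (f a + sum (map f l))              ∎
    where open ≡-Reasoning

  sum-map-∑-comm : ∀ {n} (f : Fin n → A → ℕ) l →
                   ∑[ x < n ] sum (map (f x) l) ≡ sum (map (λ a → ∑[ x < n ] f x a) l)
  sum-map-∑-comm {n} f []      = sum-replicate-zero n
  sum-map-∑-comm {n} f (a ∷ l) = begin
    ∑[ x < n ] (f x a + sum (map (f x) l))                ≡⟨ ∑-distrib-+ (λ x → f x a) _ ⟩
    ∑[ x < n ] f x a + ∑[ x < n ] sum (map (f x) l)       ≡⟨ cong (∑[ x < n ] f x a +_) (sum-map-∑-comm f l) ⟩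
    ∑[ x < n ] f x a + sum (map (λ a → ∑[ x < n ] f x a) l) ∎
    where open ≡-Reasoning

∑-≤ : ∀ {n c} (f : Fin n → ℕ) → (∀ x → f x ≤ c) → ∑[ x < n ] f x ≤ n * c
∑-≤ {zero}  f f≤c = z≤n
∑-≤ {suc n} f f≤c = +-mono-≤ (f≤c zero) (∑-≤ (λ x → f (suc x)) (λ x → f≤c (suc x)))

∑-bit-≟ : ∀ {n} (a : Fin n) → ∑[ x < n ] bit (does (x ≟ a)) ≡ 1
∑-bit-≟ {suc n} zero    = cong suc (sum-replicate-zero n)
∑-bit-≟ {suc n} (suc a) = ∑-bit-≟ a

module _ {n : ℕ} where

  ∑ₑ : (Edge n → ℕ) → ℕ
  ∑ₑ f = sum (map f (edgesOf n))

  degree : Fin n → ℕ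
  degree x = ∑ₑ (λ e → bit (incident x e))

  negDegree : Signature n → Fin n → ℕ
  negDegree σ x = ∑ₑ (λ e → bit (σ e ∧ incident x e))

  size≡∑ₑ : (σ : Signature n) → size σ ≡ ∑ₑ (λ e → bit (σ e))
  size≡∑ₑ σ = go (edgesOf n)
    where
    go : ∀ l → length (filter (λ e → Data.Bool._≟_ (σ e) true) l) ≡ sum (map (λ e → bit (σ e)) l)
    go []      = refl
    go (e ∷ l) with σ e
    ... | true  = cong suc (go l)
    ... | false = go l

  size-switch : ∀ (σ : Signature n) x → size (switch x σ) + 2 * negDegree σ x ≡ size σ + degree x
  size-switch σ x = begin
    size (switch x σ) + 2 * negDegree σ x
      ≡⟨ cong₂ _+_ (size≡∑ₑ (switch x σ)) (sym (sum-map-*ˡ 2 (λ e → bit (σ e ∧ incident x e)) (edgesOf n))) ⟩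
    ∑ₑ (λ e → bit (σ e xor incident x e)) + ∑ₑ (λ e → 2 * bit (σ e ∧ incident x e))
      ≡⟨ sym (sum-map-+ _ _ (edgesOf n)) ⟩
    ∑ₑ (λ e → bit (σ e xor incident x e) + 2 * bit (σ e ∧ incident x e))
      ≡⟨ cong sum (map-cong (λ e → bit-xor+2*∧ (σ e) (incident x e)) (edgesOf n)) ⟩
    ∑ₑ (λ e → bit (σ e) + bit (incident x e))
      ≡⟨ sum-map-+ _ _ (edgesOf n) ⟩
    ∑ₑ (λ e → bit (σ e)) + degree x
      ≡⟨ cong (_+ degree x) (sym (size≡∑ₑ σ)) ⟩
    size σ + degree x
      ∎
    where open ≡-Reasoning

  bit-≟-∨ : ∀ {a b : Fin n} → a ≢ b → ∀ x →
            bit (does (x ≟ a) ∨ does (x ≟ b)) ≡ bit (does (x ≟ a)) + bit (does (x ≟ b))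
  bit-≟-∨ {a} {b} a≢b x with x ≟ a
  ... | no _     = refl
  ... | yes refl with x ≟ b
  ...   | yes x≡b = contradiction x≡b a≢b
  ...   | no _    = refl

  ∑-incident : (e : Edge n) → ∑[ x < n ] bit (incident x e) ≡ 2
  ∑-incident (edge a b a<b) = begin
    ∑[ x < n ] bit (does (x ≟ a) ∨ does (x ≟ b))
      ≡⟨ sum-cong-≗ (bit-≟-∨ (λ a≡b → <⇒≢ a<b (cong toℕ a≡b))) ⟩
    ∑[ x < n ] (bit (does (x ≟ a)) + bit (does (x ≟ b)))
      ≡⟨ ∑-distrib-+ (λ x → bit (does (x ≟ a))) _ ⟩
    ∑[ x < n ] bit (does (x ≟ a)) + ∑[ x < n ] bit (does (x ≟ b))
      ≡⟨ cong₂ _+_ (∑-bit-≟ a) (∑-bit-≟ b) ⟩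
    2 ∎
    where open ≡-Reasoning

  ∑-negDegree : (σ : Signature n) → ∑[ x < n ] negDegree σ x ≡ 2 * size σ
  ∑-negDegree σ = begin
    ∑[ x < n ] negDegree σ x
      ≡⟨ sum-map-∑-comm (λ x e → bit (σ e ∧ incident x e)) (edgesOf n) ⟩
    ∑ₑ (λ e → ∑[ x < n ] bit (σ e ∧ incident x e))
      ≡⟨ cong sum (map-cong edge-term (edgesOf n)) ⟩
    ∑ₑ (λ e → 2 * bit (σ e))
      ≡⟨ sum-map-*ˡ 2 (λ e → bit (σ e)) (edgesOf n) ⟩
    2 * ∑ₑ (λ e → bit (σ e))
      ≡⟨ cong (2 *_) (sym (size≡∑ₑ σ)) ⟩
    2 * size σ ∎
    where
    open ≡-Reasoning
    edge-term : ∀ e → ∑[ x < n ] bit (σ e ∧ incident x e) ≡ 2 * bit (σ e)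
    edge-term e with σ e
    ... | true  = ∑-incident e
    ... | false = sum-replicate-zero n

  LocallyMinimal : Signature n → Set
  LocallyMinimal σ = ∀ x → size σ ≤ size (switch x σ)

  SwitchEquiv-switchʳ : ∀ {σ τ : Signature n} x → SwitchEquiv σ τ → SwitchEquiv σ (switch x τ)
  SwitchEquiv-switchʳ x (same σ≐τ)  = step x (same (λ e → cong (_xor incident x e) (σ≐τ e)))
  SwitchEquiv-switchʳ x (step y eq) = step y (SwitchEquiv-switchʳ x eq)

  minimal⇒locallyMinimal : ∀ {σ σ' : Signature n} → MinimalEquiv σ σ' → LocallyMinimal σ'
  minimal⇒locallyMinimal {σ' = σ'} (σ~σ' , least) x = least (switch x σ') (SwitchEquiv-switchʳ x σ~σ')

  locallyMinimal⇒2*negDegree≤degree : ∀ (σ : Signature n) → LocallyMinimal σ → ∀ x → 2 * negDegree σ x ≤ degree x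
  locallyMinimal⇒2*negDegree≤degree σ locMin x = +-cancelˡ-≤ (size σ) (2 * negDegree σ x) (degree x) (begin
    size σ + 2 * negDegree σ x               ≤⟨ +-mono-≤ (locMin x) ≤-refl ⟩
    size (switch x σ) + 2 * negDegree σ x    ≡⟨ size-switch σ x ⟩
    size σ + degree x                        ∎)
    where open ≤-Reasoning

degree-K₆ : (x : Fin 6) → degree x ≡ 5
degree-K₆ zero                                = refl
degree-K₆ (suc zero)                          = refl
degree-K₆ (suc (suc zero))                    = refl
degree-K₆ (suc (suc (suc zero)))              = refl
degree-K₆ (suc (suc (suc (suc zero))))        = refl
degree-K₆ (suc (suc (suc (suc (suc zero))))) = refl

mainTheorem2 : (σ σ' : Signature 6) → MinimalEquiv σ σ' → size σ' ≤ 6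
mainTheorem2 σ σ' minimal = *-cancelˡ-≤ 2 (begin
  2 * size σ'                ≡⟨ sym (∑-negDegree σ') ⟩
  ∑[ x < 6 ] negDegree σ' x  ≤⟨ ∑-≤ (negDegree σ') negDegree≤2 ⟩
  12                         ∎)
  where
  open ≤-Reasoning
  locallyMinimal : LocallyMinimal σ'
  locallyMinimal = minimal⇒locallyMinimal {σ = σ} minimal

  negDegree≤2 : ∀ x → negDegree σ' x ≤ 2
  negDegree≤2 x = s≤s⁻¹ (*-cancelˡ-< 2 (negDegree σ' x) 3 (s≤s
    (subst (2 * negDegree σ' x ≤_) (degree-K₆ x) (locallyMinimal⇒2*negDegree≤degree σ' locallyMinimal x))))
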